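{- Fix $k\ge2$ and write $A_xy=A_x(k,y)$. If the number $A_ab$ is in normal form, i.e. $A_ab\equiv_k A_ab+0$, and $0<p<k$, then $A_ab\cdot p$ is in extended normal form, i.e. $A_ab\cdot p\equiv^{e}_k A_ab\cdot p+0$.
   Context: Ackermann function: for $k\ge 2$, $a,b\ge 0$: $A_a(k,-1):=1$, $A_0(k,b):=k^b$, $A_{a+1}(k,b):=A_a(k,\cdot)^k(A_{a+1}(k,b-1))$, with $f^j$ the $j$-fold iterate. $k$-normal form: for $m>0$, $m\equiv_k A_ab+c$ means $m=A_ab+c$ and there exist $n\ge1$ and naturals $a_1..a_n$, $b_1..b_n$, $m_0..m_n$ with $m_0=0$; for $0\le i<n$: $A_{a_{i+1}}m_i\le m<A_{a_{i+1}+1}m_i$, $A_{a_{i+1}}b_{i+1}\le m<A_{a_{i+1}}(b_{i+1}+1)$, $m_{i+1}=A_{a_{i+1}}b_{i+1}$; $A_0m_n>m$; $a=a_n$, $b=b_n$ (unique for each $m>0$). Extended $k$-normal form: $m\equiv^e_k A_ab\cdot p+q$ means $m\equiv_k A_ab+c$ for some $c$, $m=A_ab\cdot p+q$, and $0\le q<A_ab$. -}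

module Defs where

open import Data.Nat using (ℕ; zero; suc; _+_; _*_; _^_; _≤_; _<_)
open import Data.Product using (Σ; _×_; ∃-syntax; Σ-syntax)
open import Relation.Binary.PropositionalEquality using (_≡_)

iter : (ℕ → ℕ) → ℕ → ℕ → ℕ
iter f zero    x = x
iter f (suc j) x = f (iter f j x)

-- Ackermann' k a n = A_a(k, n - 1), i.e. the second argument is shifted by one
-- so that the value A_a(k,-1) = 1 can be represented.
Ackermann' : ℕ → ℕ → ℕ → ℕ
Ackermann' k a       zero          = 1
Ackermann' k zero    (suc b)       = k ^ b
Ackermann' k (suc a) (suc b)       =
  iter (λ x → Ackermann' k a (suc x)) k (Ackermann' k (suc a) b)

Ack : ℕ → ℕ → ℕ → ℕ
Ack k a b = Ackermann' k a (suc b)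

-- k-normal form:  m ≡_k A_a b + c
-- The finite sequences a_1..a_n, b_1..b_n, m_0..m_n are represented by
-- functions ℕ → ℕ of which only the entries with index in range matter.
NormalForm : (k m a b c : ℕ) → Set
NormalForm k m a b c =
  0 < m × m ≡ Ack k a b + c ×
  Σ[ n ∈ ℕ ] Σ[ as ∈ (ℕ → ℕ) ] Σ[ bs ∈ (ℕ → ℕ) ] Σ[ ms ∈ (ℕ → ℕ) ]
    ( 1 ≤ n
    × ms 0 ≡ 0
    × (∀ i → i < n →
          Ack k (as (suc i)) (ms i) ≤ m
        × m < Ack k (suc (as (suc i))) (ms i)
        × Ack k (as (suc i)) (bs (suc i)) ≤ m
        × m < Ack k (as (suc i)) (suc (bs (suc i)))
        × ms (suc i) ≡ Ack k (as (suc i)) (bs (suc i)))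
    × m < Ack k 0 (ms n)
    × a ≡ as n
    × b ≡ bs n )

ExtNormalForm : (k m a b p q : ℕ) → Set
ExtNormalForm k m a b p q =
  Σ[ c ∈ ℕ ] NormalForm k m a b c
  × m ≡ Ack k a b * p + q
  × q < Ack k a b

module Submission where

open import Defs
open import Data.Nat
  using (ℕ; zero; suc; _+_; _*_; _∸_; _^_; _≤_; _<_; z≤n; s≤s; NonZero; >-nonZero)
open import Data.Nat.Properties
open import Data.Product using (∃-syntax; _,_)
open import Relation.Binary.PropositionalEquality using (_≡_; refl; sym)
open import Relation.Nullary using (yes; no; contradiction)

-- Every value of the Ackermann function is a power of k, and if k^e < X for a
-- power X = k^f then already k^(e+1) ≤ X, so k^e · p < X for every p < k.
-- Hence multiplying A_a b by p keeps it below every bound occurring in its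
-- normal form, while the lower bounds only improve: the normal form of
-- A_a b · p is that of A_a b, with the surplus moved into the remainder.

IsPowerOf : ℕ → ℕ → Set
IsPowerOf k m = ∃[ e ] m ≡ k ^ e

iter-closed : (P : ℕ → Set) (f : ℕ → ℕ) → (∀ x → P (f x)) →
              ∀ {x} → P x → ∀ j → P (iter f j x)
iter-closed P f Pf Px zero    = Px
iter-closed P f Pf Px (suc j) = Pf _

Ackermann'-isPowerOf : ∀ k a n → IsPowerOf k (Ackermann' k a n)
Ackermann'-isPowerOf k a       zero    = 0 , refl
Ackermann'-isPowerOf k zero    (suc b) = b , refl
Ackermann'-isPowerOf k (suc a) (suc b) =
  iter-closed (IsPowerOf k) _ (λ x → Ackermann'-isPowerOf k a (suc x))
    (Ackermann'-isPowerOf k (suc a) b) k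

Ack-isPowerOf : ∀ k a b → IsPowerOf k (Ack k a b)
Ack-isPowerOf k a b = Ackermann'-isPowerOf k a (suc b)

^-cancelʳ-< : ∀ k .{{_ : NonZero k}} {e f} → k ^ e < k ^ f → e < f
^-cancelʳ-< k {e} {f} k^e<k^f with e <? f
... | yes e<f = e<f
... | no  e≮f = contradiction (^-monoʳ-≤ k (≮⇒≥ e≮f)) (<⇒≱ k^e<k^f)

IsPowerOf-*-< : ∀ {k m X p} → 2 ≤ k → p < k →
                IsPowerOf k m → IsPowerOf k X → m < X → m * p < X
IsPowerOf-*-< {k} {p = p} 2≤k p<k (e , refl) (f , refl) k^e<k^f = begin-strict
  k ^ e * p  <⟨ *-monoʳ-< (k ^ e) {{m^n≢0 k e}} p<k ⟩
  k ^ e * k  ≡⟨ *-comm (k ^ e) k ⟩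
  k ^ suc e  ≤⟨ ^-monoʳ-≤ k (^-cancelʳ-< k {e} {f} k^e<k^f) ⟩
  k ^ f      ∎
  where
    open ≤-Reasoning
    instance
      k≢0 : NonZero k
      k≢0 = >-nonZero (<-≤-trans (s≤s z≤n) 2≤k)

NormalForm-raise : ∀ {k m m′ a b c c′} →
                   (∀ {X} → IsPowerOf k X → m < X → m′ < X) → m ≤ m′ →
                   m′ ≡ Ack k a b + c′ →
                   NormalForm k m a b c → NormalForm k m′ a b c′
NormalForm-raise {k} below m≤m′ m′≡ (0<m , _ , n , as , bs , ms , 1≤n , ms₀ , steps , last , a≡ , b≡) =
  <-≤-trans 0<m m≤m′ , m′≡ , n , as , bs , ms , 1≤n , ms₀ ,
  (λ i i<n → let (lo , hi , lo′ , hi′ , ms≡) = steps i i<n in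
    ≤-trans lo m≤m′ , below (Ack-isPowerOf k (suc (as (suc i))) (ms i)) hi ,
    ≤-trans lo′ m≤m′ , below (Ack-isPowerOf k (as (suc i)) (suc (bs (suc i)))) hi′ , ms≡) ,
  below (Ack-isPowerOf k 0 (ms n)) last , a≡ , b≡

corollary3p9 : (k a b p : ℕ) → 2 ≤ k →
    NormalForm k (Ack k a b) a b 0 →
    0 < p → p < k →
    ExtNormalForm k (Ack k a b * p) a b p 0
corollary3p9 k a b p 2≤k nf@(0<m , _) 0<p p<k =
  m * p ∸ m ,
  NormalForm-raise (IsPowerOf-*-< 2≤k p<k (Ack-isPowerOf k a b))
    m≤m*p (sym (m+[n∸m]≡n m≤m*p)) nf ,
  sym (+-identityʳ (m * p)) , 0<m
  where
    m = Ack k a b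
    m≤m*p : m ≤ m * p
    m≤m*p = m≤m*n m p {{>-nonZero 0<p}}
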